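{- There are formulas $\phi(x,y,z;\bar t)$ and $\psi(x,y,z;\bar t)$ in the language $\{<_1,<_2\}$ (two binary relation symbols) such that for each $k<\omega$ there is a $\{<_1,<_2\}$-structure $P_k$ in which $<_1$ and $<_2$ are linear orders, and there are elements $a_0,a_1,\bar a$ of $P_k$ such that the structure $([a_0,a_1]_2;\phi(x,y,z;\bar a),\psi(x,y,z;\bar a))$ is isomorphic to $(\{0,\dots,k-1\};+,\times)$, where $+$ and $\times$ are viewed as ternary relations (their graphs).
   Context: $[a,b]_2$ denotes the interval $\{x : a\leq_2 x\leq_2 b\}$. -}

module Defs where

open import Data.Nat using (ℕ; suc; _+_; _*_)
open import Data.Fin using (Fin; toℕ)
open import Data.Vec using (Vec; lookup; _∷_)
open import Data.Product using (Σ; ∃; _×_; _,_)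
open import Data.Sum using (_⊎_)
open import Data.Empty using (⊥)
open import Data.Unit using (⊤)
open import Relation.Nullary using (¬_)
open import Relation.Binary.PropositionalEquality using (_≡_)
open import Relation.Binary.Structures using (IsStrictTotalOrder)
open import Function.Bundles using (_⇔_)

-- First-order formulas in the language {<₁, <₂} (with equality),
-- free variables given by de Bruijn indices in Fin n.
data Formula (n : ℕ) : Set where
  lt₁ lt₂ eq : Fin n → Fin n → Formula n
  ⊤f ⊥f      : Formula n
  ¬f_        : Formula n → Formula n
  _∧f_ _∨f_ _⇒f_ : Formula n → Formula n → Formula n
  ∀f ∃f      : Formula (suc n) → Formula n

record Structure : Set₁ where
  field
    Carrier : Set
    _<₁_ _<₂_ : Carrier → Carrier → Set

open Structure public

extend : {A : Set} {n : ℕ} → A → (Fin n → A) → Fin (suc n) → A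
extend a ρ Fin.zero = a
extend a ρ (Fin.suc i) = ρ i

Sat : (M : Structure) {n : ℕ} → Formula n → (Fin n → Carrier M) → Set
Sat M (lt₁ i j) ρ = _<₁_ M (ρ i) (ρ j)
Sat M (lt₂ i j) ρ = _<₂_ M (ρ i) (ρ j)
Sat M (eq i j) ρ = ρ i ≡ ρ j
Sat M ⊤f ρ = ⊤
Sat M ⊥f ρ = ⊥
Sat M (¬f φ) ρ = ¬ Sat M φ ρ
Sat M (φ ∧f ψ) ρ = Sat M φ ρ × Sat M ψ ρ
Sat M (φ ∨f ψ) ρ = Sat M φ ρ ⊎ Sat M ψ ρ
Sat M (φ ⇒f ψ) ρ = Sat M φ ρ → Sat M ψ ρ
Sat M (∀f φ) ρ = (a : Carrier M) → Sat M φ (extend a ρ)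
Sat M (∃f φ) ρ = Σ (Carrier M) λ a → Sat M φ (extend a ρ)

BothLinear : Structure → Set
BothLinear M = IsStrictTotalOrder _≡_ (_<₁_ M) × IsStrictTotalOrder _≡_ (_<₂_ M)

InInterval : (M : Structure) → Carrier M → Carrier M → Carrier M → Set
InInterval M a₀ a₁ x = (_<₂_ M a₀ x ⊎ a₀ ≡ x) × (_<₂_ M x a₁ ⊎ x ≡ a₁)

-- φ(x,y,z;t̄) with parameter tuple t̄ of length m: variables 0,1,2 are x,y,z,
-- variables 3..m+2 are t₀..t_{m-1}.
SatXYZ : (M : Structure) {m : ℕ} → Formula (3 + m) →
         Carrier M → Carrier M → Carrier M → Vec (Carrier M) m → Set
SatXYZ M φ x y z ā = Sat M φ (lookup (x ∷ y ∷ z ∷ ā))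

IsoToArith : (M : Structure) {m : ℕ} (φ ψ : Formula (3 + m)) (k : ℕ)
             (a₀ a₁ : Carrier M) (ā : Vec (Carrier M) m) → Set
IsoToArith M φ ψ k a₀ a₁ ā =
  Σ (Fin k → Carrier M) λ g →
    ((i : Fin k) → InInterval M a₀ a₁ (g i))
  × ((i j : Fin k) → g i ≡ g j → i ≡ j)
  × ((x : Carrier M) → InInterval M a₀ a₁ x → Σ (Fin k) λ i → g i ≡ x)
  × ((i j l : Fin k) → SatXYZ M φ (g i) (g j) (g l) ā ⇔ (toℕ i + toℕ j ≡ toℕ l))
  × ((i j l : Fin k) → SatXYZ M ψ (g i) (g j) (g l) ā ⇔ (toℕ i * toℕ j ≡ toℕ l))

-- P_k lives on ℕ.  Its second order is the usual one; its first order is read off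
-- a word w : ℕ → Item.  Positions 0,…,k-1 carry numerals (they form the interval
-- [0,k-1]₂), later positions carry separators and labels of numbers below k.
-- <₁ sorts positions by the weight of their item — label n, then numeral n, then
-- label n+1, …, separators on top — breaking ties by position.  With parameter
-- t = k, first-order formulas can therefore recognise separators (they lie above
-- all numerals), <₂-successors, and the numeral named by a label (the <₁-least
-- numeral above it).  φ says that the motif "sep, lab x, lab y, lab z" occurs in
-- w, and ψ that "sep, lab x, sep, lab y, lab z" does.
module Submission where

open import Defs
open import Data.Nat using (ℕ; _+_)
open import Data.Vec using (Vec)
open import Data.Product using (Σ; _×_)

open import Data.Nat using (zero; suc; _*_; _<_; _≤_; z≤n; s≤s; s≤s⁻¹; _<?_; _≟_)
open import Data.Nat.Properties
  using ( <-irrefl; <-trans; <-≤-trans; ≤-<-trans; ≤-reflexive; ≤-refl; <⇒≤; <⇒≱; ≮⇒≥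
        ; <-cmp; n<1+n; m<n⇒m<1+n; m≤n⇒m≤1+n; m≤n⇒m≤o+n; m≤n⇒m<n∨m≡n; m≤n⇒∃[o]m+o≡n
        ; <-isStrictTotalOrder)
open import Data.Fin as Fin using (Fin; toℕ; fromℕ<; #_)
open import Data.Fin.Properties using (toℕ<n; toℕ-injective; toℕ-fromℕ<)
open import Data.List using (List; []; _∷_; _++_; length; concatMap; applyUpTo; cartesianProduct; allFin; filter)
open import Data.List.Properties using (length-applyUpTo; concatMap-++; ++-assoc)
open import Data.List.Relation.Unary.All using (All; []; _∷_)
open import Data.List.Relation.Unary.All.Properties using (++⁺; all-filter)
open import Data.List.Relation.Unary.Any using (here; there)
open import Data.List.Membership.Propositional using (_∈_)
open import Data.List.Membership.Propositional.Properties using (∈-filter⁺; ∈-∃++; ∈-cartesianProduct⁺; ∈-allFin)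
open import Data.Vec using ([]; _∷_)
open import Data.Product using (_,_; proj₁; ∃-syntax)
open import Data.Sum using (_⊎_; inj₁; inj₂)
open import Data.Empty using (⊥-elim)
open import Data.Unit using (⊤; tt)
open import Function using (_∘_)
open import Function.Bundles using (_⇔_; mk⇔)
open import Relation.Nullary using (¬_; yes; no)
open import Relation.Unary using (Decidable)
open import Relation.Binary using (Trichotomous; Irreflexive; Transitive; IsStrictTotalOrder; tri<; tri≈; tri>)
open import Relation.Binary.PropositionalEquality
  using (_≡_; _≢_; refl; sym; trans; cong; subst; subst₂; isEquivalence; resp₂; module ≡-Reasoning)

-- Doubling, used to interleave labels (even weights) with numerals (odd weights).
double : ℕ → ℕ
double zero = zero
double (suc n) = suc (suc (double n))

double-mono : ∀ {m n} → m ≤ n → double m ≤ double n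
double-mono z≤n = z≤n
double-mono (s≤s m≤n) = s≤s (s≤s (double-mono m≤n))

-- 2m ≤ 2n + 1 forces m ≤ n; read at m = suc x it also says 2x+1 < 2n+1 ⇒ x < n.
double≤odd⇒≤ : ∀ {m n} → double m ≤ suc (double n) → m ≤ n
double≤odd⇒≤ {zero} _ = z≤n
double≤odd⇒≤ {suc m} {zero} (s≤s ())
double≤odd⇒≤ {suc m} {suc n} (s≤s (s≤s le)) = s≤s (double≤odd⇒≤ le)

-- The lexicographic order on positions: first by a key, then by position.
-- It is the first order of P_k, with the key being the weight of the item there.
module KeyedOrder (key : ℕ → ℕ) where

  _≺_ : ℕ → ℕ → Set
  p ≺ q = key p < key q ⊎ (key p ≡ key q × p < q)

  ≺⇒key≤ : ∀ {p q} → p ≺ q → key p ≤ key q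
  ≺⇒key≤ (inj₁ key<) = <⇒≤ key<
  ≺⇒key≤ (inj₂ (key≡ , _)) = ≤-reflexive key≡

  ≺-tie : ∀ {p q} → key p ≡ key q → p ≺ q → p < q
  ≺-tie key≡ (inj₁ key<) = ⊥-elim (<-irrefl key≡ key<)
  ≺-tie _ (inj₂ (_ , p<q)) = p<q

  ≺-irrefl : Irreflexive _≡_ _≺_
  ≺-irrefl refl p≺p = <-irrefl refl (≺-tie refl p≺p)

  ≺-trans : Transitive _≺_
  ≺-trans (inj₁ k₁) (inj₁ k₂) = inj₁ (<-trans k₁ k₂)
  ≺-trans (inj₁ k₁) (inj₂ (e₂ , _)) = inj₁ (<-≤-trans k₁ (≤-reflexive e₂))
  ≺-trans (inj₂ (e₁ , _)) (inj₁ k₂) = inj₁ (≤-<-trans (≤-reflexive e₁) k₂)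
  ≺-trans (inj₂ (e₁ , p₁)) (inj₂ (e₂ , p₂)) = inj₂ (trans e₁ e₂ , <-trans p₁ p₂)

  ≺-compare : Trichotomous _≡_ _≺_
  ≺-compare p q with <-cmp (key p) (key q)
  ... | tri< key< key≢ _ = tri< (inj₁ key<) (key≢ ∘ cong key) (<⇒≱ key< ∘ ≺⇒key≤)
  ... | tri> _ key≢ key> = tri> (<⇒≱ key> ∘ ≺⇒key≤) (key≢ ∘ cong key) (inj₁ key>)
  ... | tri≈ _ key≡ _ with <-cmp p q
  ...   | tri< p<q p≢q q≮p = tri< (inj₂ (key≡ , p<q)) p≢q (q≮p ∘ ≺-tie (sym key≡))
  ...   | tri≈ p≮q p≡q q≮p = tri≈ (p≮q ∘ ≺-tie key≡) p≡q (q≮p ∘ ≺-tie (sym key≡))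
  ...   | tri> p≮q p≢q q<p = tri> (p≮q ∘ ≺-tie key≡) p≢q (inj₂ (sym key≡ , q<p))

  ≺-isStrictTotalOrder : IsStrictTotalOrder _≡_ _≺_
  ≺-isStrictTotalOrder = record
    { isStrictPartialOrder = record
      { isEquivalence = isEquivalence
      ; irrefl = ≺-irrefl
      ; trans = ≺-trans
      ; <-resp-≈ = resp₂ _≺_
      }
    ; compare = ≺-compare
    }

IsSuccessor : ℕ → ℕ → Set
IsSuccessor q s = q < s × ((a : ℕ) → ¬ (q < a × a < s))

successor⇒ : ∀ {q s} → IsSuccessor q s → s ≡ suc q
successor⇒ {q} (q<s , gap) with m≤n⇒m<n∨m≡n q<s
... | inj₁ 1+q<s = ⊥-elim (gap (suc q) (n<1+n q , 1+q<s))
... | inj₂ 1+q≡s = sym 1+q≡s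

successor⇐ : ∀ q → IsSuccessor q (suc q)
successor⇐ q = n<1+n q , λ a (q<a , a<1+q) → <⇒≱ q<a (s≤s⁻¹ a<1+q)

-- The closed interval [a,b] of (ℕ, <); InInterval unfolds to it on any
-- structure whose second order is the usual order of ℕ.
InClosed : ℕ → ℕ → ℕ → Set
InClosed a b x = (a < x ⊎ a ≡ x) × (x < b ⊎ x ≡ b)

-- End points with [lo k, hi k] = {0,…,k-1}; for k = 0 the interval [1,0] is empty.
lo hi : ℕ → ℕ
lo zero = 1
lo (suc _) = 0
hi zero = 0
hi (suc k) = k

interval⁺ : ∀ {k x} → x < k → InClosed (lo k) (hi k) x
interval⁺ {suc k} (s≤s x≤k) = m≤n⇒m<n∨m≡n z≤n , m≤n⇒m<n∨m≡n x≤k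

interval⁻ : ∀ {k x} → InClosed (lo k) (hi k) x → x < k
interval⁻ {zero} (_ , inj₁ ())
interval⁻ {zero} (inj₁ () , inj₂ refl)
interval⁻ {zero} (inj₂ () , inj₂ refl)
interval⁻ {suc k} (_ , inj₁ x<k) = m<n⇒m<1+n x<k
interval⁻ {suc k} (_ , inj₂ refl) = n<1+n k

-- With the parameter t interpreted as k:
-- aboveNumeralsF s t : every a <₂ t lies <₁-below s  ("s is a separator");
-- successorF q s     : s is the <₂-successor of q;
-- namesF c x t       : x is the <₁-least element below t (in <₂) that lies <₁-above c
--                      ("the label at c names x").
aboveNumeralsF : ∀ {n} → Fin n → Fin n → Formula n
aboveNumeralsF s t = ∀f (lt₂ Fin.zero (Fin.suc t) ⇒f lt₁ Fin.zero (Fin.suc s))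

successorF : ∀ {n} → Fin n → Fin n → Formula n
successorF q s = lt₂ q s ∧f ∀f (¬f (lt₂ (Fin.suc q) Fin.zero ∧f lt₂ Fin.zero (Fin.suc s)))

namesF : ∀ {n} → Fin n → Fin n → Fin n → Formula n
namesF c x t = (lt₂ x t ∧f lt₁ c x) ∧f
  ∀f ((lt₂ Fin.zero (Fin.suc t) ∧f lt₁ (Fin.suc c) Fin.zero) ⇒f
      (lt₁ (Fin.suc x) Fin.zero ∨f eq (Fin.suc x) Fin.zero))

-- φ(x,y,z;t): positions s, c₁, c₂, c₃ are <₂-consecutive, s is a separator and
-- c₁, c₂, c₃ name x, y, z.  Inside the four quantifiers the variables are
-- c₃ = 0, c₂ = 1, c₁ = 2, s = 3, x = 4, y = 5, z = 6, t = 7.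
φ : Formula (3 + 1)
φ = ∃f (∃f (∃f (∃f (aboveNumeralsF (# 3) (# 7) ∧f (successorF (# 3) (# 2) ∧f
      (successorF (# 2) (# 1) ∧f (successorF (# 1) (# 0) ∧f (namesF (# 2) (# 4) (# 7) ∧f
      (namesF (# 1) (# 5) (# 7) ∧f namesF (# 0) (# 6) (# 7))))))))))

-- ψ(x,y,z;t): positions s, c₁, s₂, c₂, c₃ are <₂-consecutive, s and s₂ are
-- separators and c₁, c₂, c₃ name x, y, z.  Inside the five quantifiers the
-- variables are c₃ = 0, c₂ = 1, s₂ = 2, c₁ = 3, s = 4, x = 5, y = 6, z = 7, t = 8.
ψ : Formula (3 + 1)
ψ = ∃f (∃f (∃f (∃f (∃f (aboveNumeralsF (# 4) (# 8) ∧f (successorF (# 4) (# 3) ∧f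
      (successorF (# 3) (# 2) ∧f (aboveNumeralsF (# 2) (# 8) ∧f (successorF (# 2) (# 1) ∧f
      (successorF (# 1) (# 0) ∧f (namesF (# 3) (# 5) (# 8) ∧f (namesF (# 1) (# 6) (# 8) ∧f
      namesF (# 0) (# 7) (# 8)))))))))))))

data Item : Set where
  num lab : ℕ → Item
  sep : Item

sep≢lab : ∀ {n} → sep ≢ lab n
sep≢lab ()

num≢sep : ∀ {n} → num n ≢ sep
num≢sep ()

weight : ℕ → Item → ℕ
weight k (lab n) = double n
weight k (num n) = suc (double n)
weight k sep = double k

Marker : ℕ → Item → Set
Marker k it = it ≡ sep ⊎ ∃[ n ] (n < k × it ≡ lab n)

cell : List Item → ℕ → Item
cell [] _ = sep
cell (it ∷ _) zero = it
cell (_ ∷ its) (suc p) = cell its p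

cell-++ : ∀ (xs : List Item) {ys q} → cell (xs ++ ys) (length xs + q) ≡ cell ys q
cell-++ [] = refl
cell-++ (_ ∷ xs) = cell-++ xs

cell-applyUpTo : ∀ (f : ℕ → Item) n ys {p} → p < n → cell (applyUpTo f n ++ ys) p ≡ f p
cell-applyUpTo f (suc n) ys {zero} _ = refl
cell-applyUpTo f (suc n) ys {suc p} (s≤s p<n) = cell-applyUpTo (f ∘ suc) n ys p<n

cell-All : ∀ {P : Item → Set} {xs} → P sep → All P xs → ∀ q → P (cell xs q)
cell-All P-sep [] _ = P-sep
cell-All P-sep (P-x ∷ _) zero = P-x
cell-All P-sep (_ ∷ P-xs) (suc q) = cell-All P-sep P-xs q

Reads : (ℕ → Item) → ℕ → List Item → Set
Reads w p [] = ⊤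
Reads w p (it ∷ its) = w p ≡ it × Reads w (suc p) its

Occurs : (ℕ → Item) → List Item → Set
Occurs w pat = Σ ℕ λ p → Reads w p pat

Reads-cons : ∀ {it xs q} pat → Reads (cell xs) q pat → Reads (cell (it ∷ xs)) (suc q) pat
Reads-cons [] _ = tt
Reads-cons (_ ∷ pat) (e , r) = e , Reads-cons pat r

Reads-uncons : ∀ {it xs q} pat → Reads (cell (it ∷ xs)) (suc q) pat → Reads (cell xs) q pat
Reads-uncons [] _ = tt
Reads-uncons (_ ∷ pat) (e , r) = e , Reads-uncons pat r

Reads-after : ∀ xs {ys q pat} → Reads (cell ys) q pat → Reads (cell (xs ++ ys)) (length xs + q) pat
Reads-after [] r = r
Reads-after (_ ∷ xs) {pat = pat} r = Reads-cons pat (Reads-after xs r)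

Reads-before : ∀ xs {ys q pat} → Reads (cell (xs ++ ys)) (length xs + q) pat → Reads (cell ys) q pat
Reads-before [] r = r
Reads-before (_ ∷ xs) {pat = pat} r = Reads-before xs (Reads-uncons pat r)

Reads-prefix : ∀ pat ys → Reads (cell (pat ++ ys)) 0 pat
Reads-prefix [] _ = tt
Reads-prefix (_ ∷ pat) ys = refl , Reads-cons pat (Reads-prefix pat ys)

data Op : Set where
  plus times : Op

apply : Op → ℕ → ℕ → ℕ
apply plus = _+_
apply times = _*_

motif : Op → ℕ → ℕ → ℕ → List Item
motif plus a b c = sep ∷ lab a ∷ lab b ∷ lab c ∷ []
motif times a b c = sep ∷ lab a ∷ sep ∷ lab b ∷ lab c ∷ []

module Model (k : ℕ) (w : ℕ → Item)
             (numeral-at : ∀ {p} → p < k → w p ≡ num p)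
             (marker-past : ∀ {p} → k ≤ p → Marker k (w p)) where

  open KeyedOrder (λ p → weight k (w p)) public

  P : Structure
  P = record { Carrier = ℕ ; _<₁_ = _≺_ ; _<₂_ = _<_ }

  P-linear : BothLinear P
  P-linear = ≺-isStrictTotalOrder , <-isStrictTotalOrder

  weight-numeral : ∀ {x} → x < k → weight k (w x) ≡ suc (double x)
  weight-numeral x<k = cong (weight k) (numeral-at x<k)

  ≺-weights : ∀ {p q i j} → p ≺ q → w p ≡ i → w q ≡ j → weight k i ≤ weight k j
  ≺-weights p≺q refl refl = ≺⇒key≤ p≺q

  numerals-≺ : ∀ {x a} → x < k → a < k → x < a → x ≺ a
  numerals-≺ x<k a<k x<a =
    inj₁ (subst₂ _<_ (sym (weight-numeral x<k)) (sym (weight-numeral a<k)) (m≤n⇒m≤1+n (double-mono x<a)))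

  ≺-numerals : ∀ {x a} → x < k → a < k → x ≺ a → x < a
  ≺-numerals x<k a<k (inj₁ weight<) =
    double≤odd⇒≤ (subst₂ _<_ (weight-numeral x<k) (weight-numeral a<k) weight<)
  ≺-numerals _ _ (inj₂ (_ , x<a)) = x<a

  label-≺ : ∀ {c n a} → w c ≡ lab n → n ≤ a → a < k → c ≺ a
  label-≺ {c} label n≤a a<k =
    inj₁ (subst₂ _<_ (sym (cong (weight k) label)) (sym (weight-numeral a<k)) (s≤s (double-mono n≤a)))

  sep-past : ∀ {p} → w p ≡ sep → k ≤ p
  sep-past is-sep = ≮⇒≥ λ p<k → num≢sep (trans (sym (numeral-at p<k)) is-sep)

  AboveNumerals : ℕ → Set
  AboveNumerals s = (a : ℕ) → a < k → a ≺ s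

  separator⇒above : ∀ {s} → w s ≡ sep → AboveNumerals s
  separator⇒above is-sep a a<k =
    inj₁ (subst₂ _<_ (sym (weight-numeral a<k)) (sym (cong (weight k) is-sep)) (double-mono a<k))

  above⇒separator : ∀ {s} → AboveNumerals s → w s ≡ sep
  above⇒separator {s} above with s <? k
  ... | yes s<k = ⊥-elim (≺-irrefl refl (above s s<k))
  ... | no s≮k with marker-past (≮⇒≥ s≮k)
  ...   | inj₁ is-sep = is-sep
  ...   | inj₂ (n , n<k , is-lab) = ⊥-elim (<-irrefl refl (≺-weights (above n n<k) (numeral-at n<k) is-lab))

  Names : ℕ → ℕ → Set
  Names c x = (x < k × c ≺ x) × ((a : ℕ) → a < k × c ≺ a → x ≺ a ⊎ x ≡ a)

  label⇒names : ∀ {c x} → w c ≡ lab x → x < k → Names c x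
  label⇒names {c} {x} is-lab x<k = (x<k , label-≺ is-lab ≤-refl x<k) , least
    where
    least : (a : ℕ) → a < k × c ≺ a → x ≺ a ⊎ x ≡ a
    least a (a<k , c≺a) with m≤n⇒m<n∨m≡n (double≤odd⇒≤ (≺-weights c≺a is-lab (numeral-at a<k)))
    ... | inj₁ x<a = inj₁ (numerals-≺ x<k a<k x<a)
    ... | inj₂ x≡a = inj₂ x≡a

  names⇒label : ∀ {c x} → k ≤ c → Names c x → w c ≡ lab x
  names⇒label {c} {x} k≤c ((x<k , c≺x) , least) with marker-past k≤c
  ... | inj₁ is-sep = ⊥-elim (<⇒≱ x<k (double≤odd⇒≤ (≺-weights c≺x is-sep (numeral-at x<k))))
  ... | inj₂ (n , n<k , is-lab) = trans is-lab (cong lab (sym x≡n))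
    where
    n≤x : n ≤ x
    n≤x = double≤odd⇒≤ (≺-weights c≺x is-lab (numeral-at x<k))
    x≡n : x ≡ n
    x≡n with least n (n<k , label-≺ is-lab ≤-refl n<k)
    ... | inj₁ x≺n = ⊥-elim (<⇒≱ (≺-numerals x<k n<k x≺n) n≤x)
    ... | inj₂ x≡n = x≡n

  φ⇒occurs : ∀ {x y z} → SatXYZ P φ x y z (k ∷ []) → Occurs w (motif plus x y z)
  φ⇒occurs (s , c₁ , c₂ , c₃ , above , s₁ , s₂ , s₃ , names₁ , names₂ , names₃)
    with successor⇒ s₁ | successor⇒ s₂ | successor⇒ s₃
  ... | refl | refl | refl =
    s , is-sep , names⇒label (past 1) names₁ , names⇒label (past 2) names₂ ,
    names⇒label (past 3) names₃ , tt
    where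
    is-sep : w s ≡ sep
    is-sep = above⇒separator above
    past : ∀ d → k ≤ d + s
    past d = m≤n⇒m≤o+n d (sep-past is-sep)

  occurs⇒φ : ∀ {x y z} → x < k → y < k → z < k → Occurs w (motif plus x y z) → SatXYZ P φ x y z (k ∷ [])
  occurs⇒φ x<k y<k z<k (p , is-sep , lab-x , lab-y , lab-z , _) =
    p , suc p , suc (suc p) , suc (suc (suc p)) , separator⇒above is-sep ,
    successor⇐ p , successor⇐ (suc p) , successor⇐ (suc (suc p)) ,
    label⇒names lab-x x<k , label⇒names lab-y y<k , label⇒names lab-z z<k

  ψ⇒occurs : ∀ {x y z} → SatXYZ P ψ x y z (k ∷ []) → Occurs w (motif times x y z)
  ψ⇒occurs (s , c₁ , s₂ , c₂ , c₃ , above , t₁ , t₂ , above₂ , t₃ , t₄ , names₁ , names₂ , names₃)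
    with successor⇒ t₁ | successor⇒ t₂ | successor⇒ t₃ | successor⇒ t₄
  ... | refl | refl | refl | refl =
    s , is-sep , names⇒label (past 1) names₁ , above⇒separator above₂ ,
    names⇒label (past 3) names₂ , names⇒label (past 4) names₃ , tt
    where
    is-sep : w s ≡ sep
    is-sep = above⇒separator above
    past : ∀ d → k ≤ d + s
    past d = m≤n⇒m≤o+n d (sep-past is-sep)

  occurs⇒ψ : ∀ {x y z} → x < k → y < k → z < k → Occurs w (motif times x y z) → SatXYZ P ψ x y z (k ∷ [])
  occurs⇒ψ x<k y<k z<k (p , is-sep , lab-x , is-sep₂ , lab-y , lab-z , _) =
    p , suc p , suc (suc p) , suc (suc (suc p)) , suc (suc (suc (suc p))) , separator⇒above is-sep ,
    successor⇐ p , successor⇐ (suc p) , separator⇒above is-sep₂ , successor⇐ (suc (suc p)) ,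
    successor⇐ (suc (suc (suc p))) , label⇒names lab-x x<k , label⇒names lab-y y<k , label⇒names lab-z z<k

module Encoding (k : ℕ) where

  Block : Set
  Block = Op × Fin k × Fin k × Fin k

  spell : Block → List Item
  spell (op , i , j , l) = motif op (toℕ i) (toℕ j) (toℕ l)

  Valid : Block → Set
  Valid (op , i , j , l) = apply op (toℕ i) (toℕ j) ≡ toℕ l

  valid? : Decidable Valid
  valid? (op , i , j , l) = apply op (toℕ i) (toℕ j) ≟ toℕ l

  allBlocks : List Block
  allBlocks = cartesianProduct (plus ∷ times ∷ [])
                (cartesianProduct (allFin k) (cartesianProduct (allFin k) (allFin k)))

  blocks : List Block
  blocks = filter valid? allBlocks

  numerals : List Item
  numerals = applyUpTo num k

  text : List Item
  text = concatMap spell blocks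

  word : ℕ → Item
  word = cell (numerals ++ text)

  numeral-at : ∀ {p} → p < k → word p ≡ num p
  numeral-at = cell-applyUpTo num k text

  past-numerals : ∀ q → k + q ≡ length numerals + q
  past-numerals q = cong (_+ q) (sym (length-applyUpTo num k))

  label-marker : (i : Fin k) → Marker k (lab (toℕ i))
  label-marker i = inj₂ (toℕ i , toℕ<n i , refl)

  spelling-markers : ∀ b → All (Marker k) (spell b)
  spelling-markers (plus , i , j , l) =
    inj₁ refl ∷ label-marker i ∷ label-marker j ∷ label-marker l ∷ []
  spelling-markers (times , i , j , l) =
    inj₁ refl ∷ label-marker i ∷ inj₁ refl ∷ label-marker j ∷ label-marker l ∷ []

  text-markers : ∀ bs → All (Marker k) (concatMap spell bs)
  text-markers [] = []
  text-markers (b ∷ bs) = ++⁺ (spelling-markers b) (text-markers bs)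

  marker-past : ∀ {p} → k ≤ p → Marker k (word p)
  marker-past k≤p with m≤n⇒∃[o]m+o≡n k≤p
  ... | q , refl =
    subst (Marker k) (sym (trans (cong word (past-numerals q)) (cell-++ numerals)))
      (cell-All (inj₁ refl) (text-markers blocks) q)

  open Model k word numeral-at marker-past public

  -- Soundness: in a text of valid blocks, each motif occurs only at the start of a
  -- block of its own kind.  A times block followed by anything starts with
  -- "sep, lab, sep, lab, lab, sep", which hides no plus motif.
  starts-with-sep : ∀ bs → cell (concatMap spell bs) 0 ≡ sep
  starts-with-sep [] = refl
  starts-with-sep ((plus , _) ∷ _) = refl
  starts-with-sep ((times , _) ∷ _) = refl

  plus-sound-in : ∀ {x y z} bs q → All Valid bs →
                  Reads (cell (concatMap spell bs)) q (motif plus x y z) → x + y ≡ z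
  plus-sound-in [] _ _ (_ , () , _)
  plus-sound-in ((plus , _) ∷ _) 0 (valid ∷ _) (refl , refl , refl , refl , _) = valid
  plus-sound-in ((plus , _) ∷ _) 1 _ (() , _)
  plus-sound-in ((plus , _) ∷ _) 2 _ (() , _)
  plus-sound-in ((plus , _) ∷ _) 3 _ (() , _)
  plus-sound-in ((plus , _) ∷ bs) (suc (suc (suc (suc q)))) (_ ∷ valid) r = plus-sound-in bs q valid r
  plus-sound-in ((times , _) ∷ _) 0 _ (_ , _ , () , _)
  plus-sound-in ((times , _) ∷ _) 1 _ (() , _)
  plus-sound-in ((times , _) ∷ bs) 2 _ (_ , _ , _ , next , _) =
    ⊥-elim (sep≢lab (trans (sym (starts-with-sep bs)) next))
  plus-sound-in ((times , _) ∷ _) 3 _ (() , _)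
  plus-sound-in ((times , _) ∷ _) 4 _ (() , _)
  plus-sound-in ((times , _) ∷ bs) (suc (suc (suc (suc (suc q))))) (_ ∷ valid) r = plus-sound-in bs q valid r

  times-sound-in : ∀ {x y z} bs q → All Valid bs →
                   Reads (cell (concatMap spell bs)) q (motif times x y z) → x * y ≡ z
  times-sound-in [] _ _ (_ , () , _)
  times-sound-in ((plus , _) ∷ _) 0 _ (_ , _ , () , _)
  times-sound-in ((plus , _) ∷ _) 1 _ (() , _)
  times-sound-in ((plus , _) ∷ _) 2 _ (() , _)
  times-sound-in ((plus , _) ∷ _) 3 _ (() , _)
  times-sound-in ((plus , _) ∷ bs) (suc (suc (suc (suc q)))) (_ ∷ valid) r = times-sound-in bs q valid r
  times-sound-in ((times , _) ∷ _) 0 (valid ∷ _) (refl , refl , refl , refl , refl , _) = valid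
  times-sound-in ((times , _) ∷ _) 1 _ (() , _)
  times-sound-in ((times , _) ∷ _) 2 _ (_ , _ , () , _)
  times-sound-in ((times , _) ∷ _) 3 _ (() , _)
  times-sound-in ((times , _) ∷ _) 4 _ (() , _)
  times-sound-in ((times , _) ∷ bs) (suc (suc (suc (suc (suc q))))) (_ ∷ valid) r = times-sound-in bs q valid r

  reads-in-text : ∀ {p pat} → word p ≡ sep → Reads word p pat → Σ ℕ λ q → Reads (cell text) q pat
  reads-in-text {pat = pat} is-sep r with m≤n⇒∃[o]m+o≡n (sep-past is-sep)
  ... | q , refl = q , Reads-before numerals (subst (λ p → Reads word p pat) (past-numerals q) r)

  plus-sound : ∀ {x y z} → Occurs word (motif plus x y z) → x + y ≡ z
  plus-sound (p , r) with reads-in-text (proj₁ r) r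
  ... | q , r′ = plus-sound-in blocks q (all-filter valid? allBlocks) r′

  times-sound : ∀ {x y z} → Occurs word (motif times x y z) → x * y ≡ z
  times-sound (p , r) with reads-in-text (proj₁ r) r
  ... | q , r′ = times-sound-in blocks q (all-filter valid? allBlocks) r′

  listed : ∀ {b} → Valid b → b ∈ blocks
  listed {op , i , j , l} valid =
    ∈-filter⁺ valid? (∈-cartesianProduct⁺ (op∈ op)
      (∈-cartesianProduct⁺ (∈-allFin i) (∈-cartesianProduct⁺ (∈-allFin j) (∈-allFin l)))) valid
    where
    op∈ : ∀ op → op ∈ plus ∷ times ∷ []
    op∈ plus = here refl
    op∈ times = there (here refl)

  spelled : ∀ {b} → b ∈ blocks → Occurs word (spell b)
  spelled {b} b∈ with ∈-∃++ b∈
  ... | front , back , blocks≡ =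
    length prefix + 0 ,
    subst (λ xs → Reads (cell xs) (length prefix + 0) (spell b)) (sym split)
      (Reads-after prefix (Reads-prefix (spell b) (concatMap spell back)))
    where
    prefix : List Item
    prefix = numerals ++ concatMap spell front
    open ≡-Reasoning
    split : numerals ++ text ≡ prefix ++ (spell b ++ concatMap spell back)
    split = begin
      numerals ++ concatMap spell blocks
        ≡⟨ cong (λ bs → numerals ++ concatMap spell bs) blocks≡ ⟩
      numerals ++ concatMap spell (front ++ b ∷ back)
        ≡⟨ cong (numerals ++_) (concatMap-++ spell front (b ∷ back)) ⟩
      numerals ++ (concatMap spell front ++ (spell b ++ concatMap spell back))
        ≡⟨ sym (++-assoc numerals (concatMap spell front) _) ⟩
      prefix ++ (spell b ++ concatMap spell back) ∎

  φ-defines-plus : (i j l : Fin k) → SatXYZ P φ (toℕ i) (toℕ j) (toℕ l) (k ∷ []) ⇔ (toℕ i + toℕ j ≡ toℕ l)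
  φ-defines-plus i j l = mk⇔ (plus-sound ∘ φ⇒occurs)
    (occurs⇒φ (toℕ<n i) (toℕ<n j) (toℕ<n l) ∘ spelled ∘ listed {plus , i , j , l})

  ψ-defines-times : (i j l : Fin k) → SatXYZ P ψ (toℕ i) (toℕ j) (toℕ l) (k ∷ []) ⇔ (toℕ i * toℕ j ≡ toℕ l)
  ψ-defines-times i j l = mk⇔ (times-sound ∘ ψ⇒occurs)
    (occurs⇒ψ (toℕ<n i) (toℕ<n j) (toℕ<n l) ∘ spelled ∘ listed {times , i , j , l})

proposition2p7 : Σ ℕ λ m → Σ (Formula (3 + m)) λ φ → Σ (Formula (3 + m)) λ ψ →
    (k : ℕ) → Σ Structure λ P → BothLinear P ×
      Σ (Carrier P) λ a₀ → Σ (Carrier P) λ a₁ → Σ (Vec (Carrier P) m) λ ā →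
        IsoToArith P φ ψ k a₀ a₁ ā
proposition2p7 = 1 , φ , ψ , λ k → let open Encoding k in
  P , P-linear , lo k , hi k , k ∷ [] ,
  toℕ , (λ i → interval⁺ (toℕ<n i)) , (λ _ _ → toℕ-injective) ,
  (λ x x∈ → fromℕ< (interval⁻ x∈) , toℕ-fromℕ< (interval⁻ x∈)) ,
  φ-defines-plus , ψ-defines-times
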